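{- Let $n\ge 3$ and work in $\mathfrak{e}_{C_n}$. Let $u_{1,3}=[e_1[e_1[e_2e_3]]]$, and for $1\le i<j\le n$ let $w_{i,j}=[e_i[e_{i+1}[\cdots[e_{j-1}e_j]\cdots]$. Then: (1) $[[e_1e_2],u_{1,3}]=u_{1,3}$; (2) if $n\ge 4$, $[[e_3e_4],u_{1,3}]=u_{1,3}$; (3) $[w_{2i+1,j},u_{1,3}]=0$ for all integers $i\ge1$ and $j$ with $2i+1<j\le n$ and $j\neq 4$; (4) $[w_{1,j},u_{1,3}]=0$ for all $3\le j\le n$.
   Context: All Lie algebras are over $\mathbb{C}$. The electrical Lie algebra $\mathfrak{e}_{C_n}$ is generated by $e_1,\dots,e_n$ subject to: $[e_i,e_j]=0$ if $|i-j|\ge 2$; $[e_i,[e_i,e_j]]=-2e_i$ if $|i-j|=1$ and $i\ne 1$; and $[e_1,[e_1,[e_1,e_2]]]=0$. -}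

module Defs where

open import Level using (Level; _⊔_) renaming (suc to lsuc)
open import Data.Nat using (ℕ; zero; suc; _≤_; _<_; _∸_; _+_)
open import Data.Product using (Σ; _×_)
open import Relation.Nullary using (¬_)
open import Data.Sum using () renaming (_⊎_ to _⊎'_)
open import Relation.Binary.PropositionalEquality using () renaming (_≡_ to _≡'_)
open import Algebra.Bundles using (CommutativeRing)
open import Algebra.Module.Bundles using (Module)

record Field (c ℓ : Level) : Set (lsuc (c ⊔ ℓ)) where
  field
    commRing : CommutativeRing c ℓ
  open CommutativeRing commRing public
  field
    0≉1     : ¬ (0# ≈ 1#)
    inverse : ∀ x → ¬ (x ≈ 0#) → Σ Carrier (λ y → (x * y) ≈ 1#)

natCast : ∀ {c ℓ} (R : CommutativeRing c ℓ) → ℕ → CommutativeRing.Carrier R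
natCast R zero    = CommutativeRing.0# R
natCast R (suc n) = CommutativeRing._+_ R (CommutativeRing.1# R) (natCast R n)

CharZero : ∀ {c ℓ} → Field c ℓ → Set ℓ
CharZero K = ∀ n → ¬ (Field._≈_ K (natCast (Field.commRing K) (suc n)) (Field.0# K))

record LieAlgebra {c ℓ : Level} (K : Field c ℓ) (m ℓm : Level)
       : Set (c ⊔ ℓ ⊔ lsuc (m ⊔ ℓm)) where
  field
    module' : Module (Field.commRing K) m ℓm
  open Module module' public
  field
    ⁅_,_⁆       : Carrierᴹ → Carrierᴹ → Carrierᴹ
    ⁅⁆-cong     : ∀ {x x' y y'} → x ≈ᴹ x' → y ≈ᴹ y' → ⁅ x , y ⁆ ≈ᴹ ⁅ x' , y' ⁆
    ⁅⁆-+ˡ       : ∀ x y z → ⁅ x +ᴹ y , z ⁆ ≈ᴹ (⁅ x , z ⁆ +ᴹ ⁅ y , z ⁆)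
    ⁅⁆-+ʳ       : ∀ x y z → ⁅ x , y +ᴹ z ⁆ ≈ᴹ (⁅ x , y ⁆ +ᴹ ⁅ x , z ⁆)
    ⁅⁆-*ˡ       : ∀ a x y → ⁅ a *ₗ x , y ⁆ ≈ᴹ (a *ₗ ⁅ x , y ⁆)
    ⁅⁆-*ʳ       : ∀ a x y → ⁅ x , a *ₗ y ⁆ ≈ᴹ (a *ₗ ⁅ x , y ⁆)
    ⁅⁆-alt      : ∀ x → ⁅ x , x ⁆ ≈ᴹ 0ᴹ
    ⁅⁆-jacobi   : ∀ x y z →
      ((⁅ x , ⁅ y , z ⁆ ⁆ +ᴹ ⁅ y , ⁅ z , x ⁆ ⁆) +ᴹ ⁅ z , ⁅ x , y ⁆ ⁆) ≈ᴹ 0ᴹ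

module _ {c ℓ m ℓm : Level} {K : Field c ℓ} (L : LieAlgebra K m ℓm) where
  open LieAlgebra L

  -- e : ℕ → L is a family satisfying the defining relations of the electrical
  -- Lie algebra e_{C_n} on the generators e 1, …, e n (indices 1-based).
  IsElectricalCn : ℕ → (ℕ → Carrierᴹ) → Set ℓm
  IsElectricalCn n e =
      (∀ i j → 1 ≤ i → i ≤ n → 1 ≤ j → j ≤ n → (j + 2 ≤ i) ⊎' (i + 2 ≤ j) →
         ⁅ e i , e j ⁆ ≈ᴹ 0ᴹ)
    × (∀ i j → 2 ≤ i → i ≤ n → 1 ≤ j → j ≤ n → (j ≡' suc i) ⊎' (i ≡' suc j) →
         ⁅ e i , ⁅ e i , e j ⁆ ⁆ ≈ᴹ -ᴹ (e i +ᴹ e i))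
    × (⁅ e 1 , ⁅ e 1 , ⁅ e 1 , e 2 ⁆ ⁆ ⁆ ≈ᴹ 0ᴹ)

  w' : (ℕ → Carrierᴹ) → ℕ → ℕ → Carrierᴹ
  w' e i zero    = e i
  w' e i (suc k) = ⁅ e i , w' e (suc i) k ⁆

  -- w_{i,j} = [e_i [e_{i+1} [ … [e_{j-1} e_j] … ]]]  (used for i < j)
  w : (ℕ → Carrierᴹ) → ℕ → ℕ → Carrierᴹ
  w e i j = w' e i (j ∸ i)

  u13 : (ℕ → Carrierᴹ) → Carrierᴹ
  u13 e = ⁅ e 1 , ⁅ e 1 , ⁅ e 2 , e 3 ⁆ ⁆ ⁆

-- Everything is a computation with the Jacobi identity, used as the Leibniz rule for
-- ad x = ⁅ x ,_⁆. Write w₁₂ = ⁅e₁e₂⁆, u₁₂ = ⁅e₁w₁₂⁆, w₁₃ = ⁅e₁⁅e₂e₃⁆⁆. The relations give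
-- ⁅w₁₂,u₁₂⁆ = 2u₁₂, hence ⁅w₁₂,u₁₃⁆ = 2u₁₃ + ⁅u₁₂,w₁₃⁆. On the other hand ad(e₁)³ kills
-- both e₂ and ⁅e₂e₃⁆, so applying it to ⁅e₂,⁅e₂e₃⁆⁆ = -2e₂ gives, by the Leibniz rule,
-- 3(⁅w₁₂,u₁₃⁆ + ⁅u₁₂,w₁₃⁆) = 0. Dividing by 3 and then by 2 (characteristic zero) yields
-- ⁅w₁₂,u₁₃⁆ = u₁₃, and also ⁅w₁₃,u₁₂⁆ = u₁₃, from which (2) and the cases j = 3, 4 of (4)
-- follow with the relations at e₃ and e₄. In the remaining cases w_{i,j} is, after
-- reassociating, a bracket with some w_{k,j}, k ≥ 5, which commutes with e₁, e₂, e₃ and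
-- hence with u₁₃.

module Submission where

open import Defs
open import Level using (Level)
open import Data.Nat using (ℕ; zero; suc; _≤_; _<_; _*_; _+_; _∸_; s≤s; z≤n)
open import Data.Nat.Properties
  using (≤-refl; ≤-trans; n≤1+n; m≤m+n; +-suc; +-monoʳ-≤; +-monoˡ-≤; *-monoʳ-≤; <⇒≤; m+[n∸m]≡n)
open import Data.Product using (_×_; _,_; proj₁; proj₂)
open import Data.Sum using (_⊎_; inj₁; inj₂)
open import Data.Empty using (⊥-elim)
open import Relation.Nullary using (¬_)
open import Relation.Binary.PropositionalEquality using (_≡_; refl; sym; subst)
import Algebra.Properties.AbelianGroup as AbelianGroupProperties
import Algebra.Definitions.RawMonoid as RawMonoidDefinitions
import Algebra.Solver.CommutativeMonoid as CommutativeMonoidSolver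
import Relation.Binary.Reasoning.Setoid as SetoidReasoning

module _ {c ℓ m ℓm : Level} {K : Field c ℓ} (L : LieAlgebra K m ℓm) where
  open LieAlgebra L
  open AbelianGroupProperties +ᴹ-abelianGroup
    using (⁻¹-involutive; ε⁻¹≈ε; ⁻¹-∙-comm; inverseˡ-unique; inverseʳ-unique; //-rightDividesʳ; x∙y⁻¹≈ε⇒x≈y)
  open RawMonoidDefinitions +ᴹ-rawMonoid using () renaming (_×_ to _×ᴹ_)
  open CommutativeMonoidSolver +ᴹ-commutativeMonoid using (solve; _⊜_; _⊕_; id)
  open SetoidReasoning ≈ᴹ-setoid

  private variable x y z t : Carrierᴹ

  ⁅⁆-congˡ : x ≈ᴹ y → ⁅ x , z ⁆ ≈ᴹ ⁅ y , z ⁆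
  ⁅⁆-congˡ x≈y = ⁅⁆-cong x≈y ≈ᴹ-refl

  ⁅⁆-congʳ : y ≈ᴹ z → ⁅ x , y ⁆ ≈ᴹ ⁅ x , z ⁆
  ⁅⁆-congʳ = ⁅⁆-cong ≈ᴹ-refl

  ⁅⁆-zeroˡ : ⁅ 0ᴹ , x ⁆ ≈ᴹ 0ᴹ
  ⁅⁆-zeroˡ {x} = begin
    ⁅ 0ᴹ , x ⁆            ≈⟨ ⁅⁆-congˡ (*ₗ-zeroˡ 0ᴹ) ⟨
    ⁅ K.0# *ₗ 0ᴹ , x ⁆    ≈⟨ ⁅⁆-*ˡ K.0# 0ᴹ x ⟩
    K.0# *ₗ ⁅ 0ᴹ , x ⁆    ≈⟨ *ₗ-zeroˡ _ ⟩
    0ᴹ                    ∎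
    where module K = Field K

  ⁅⁆-zeroʳ : ⁅ x , 0ᴹ ⁆ ≈ᴹ 0ᴹ
  ⁅⁆-zeroʳ {x} = begin
    ⁅ x , 0ᴹ ⁆            ≈⟨ ⁅⁆-congʳ (*ₗ-zeroˡ 0ᴹ) ⟨
    ⁅ x , K.0# *ₗ 0ᴹ ⁆    ≈⟨ ⁅⁆-*ʳ K.0# x 0ᴹ ⟩
    K.0# *ₗ ⁅ x , 0ᴹ ⁆    ≈⟨ *ₗ-zeroˡ _ ⟩
    0ᴹ                    ∎
    where module K = Field K

  ⁅⁆-negˡ : ⁅ -ᴹ x , y ⁆ ≈ᴹ -ᴹ ⁅ x , y ⁆
  ⁅⁆-negˡ {x} {y} = inverseˡ-unique _ _ (begin
    ⁅ -ᴹ x , y ⁆ +ᴹ ⁅ x , y ⁆  ≈⟨ ⁅⁆-+ˡ _ _ _ ⟨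
    ⁅ -ᴹ x +ᴹ x , y ⁆          ≈⟨ ⁅⁆-congˡ (-ᴹ‿inverseˡ x) ⟩
    ⁅ 0ᴹ , y ⁆                 ≈⟨ ⁅⁆-zeroˡ ⟩
    0ᴹ                         ∎)

  ⁅⁆-negʳ : ⁅ x , -ᴹ y ⁆ ≈ᴹ -ᴹ ⁅ x , y ⁆
  ⁅⁆-negʳ {x} {y} = inverseˡ-unique _ _ (begin
    ⁅ x , -ᴹ y ⁆ +ᴹ ⁅ x , y ⁆  ≈⟨ ⁅⁆-+ʳ _ _ _ ⟨
    ⁅ x , -ᴹ y +ᴹ y ⁆          ≈⟨ ⁅⁆-congʳ (-ᴹ‿inverseˡ y) ⟩
    ⁅ x , 0ᴹ ⁆                 ≈⟨ ⁅⁆-zeroʳ ⟩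
    0ᴹ                         ∎)

  ⁅⁆-neg-doubleʳ : ⁅ x , -ᴹ (y +ᴹ y) ⁆ ≈ᴹ -ᴹ (⁅ x , y ⁆ +ᴹ ⁅ x , y ⁆)
  ⁅⁆-neg-doubleʳ = ≈ᴹ-trans ⁅⁆-negʳ (-ᴹ‿cong (⁅⁆-+ʳ _ _ _))

  ⁅⁆-anticomm : ⁅ x , y ⁆ ≈ᴹ -ᴹ ⁅ y , x ⁆
  ⁅⁆-anticomm {x} {y} = inverseˡ-unique _ _ (begin
    ⁅ x , y ⁆ +ᴹ ⁅ y , x ⁆
      ≈⟨ +ᴹ-cong (+ᴹ-identityˡ _) (+ᴹ-identityʳ _) ⟨
    (0ᴹ +ᴹ ⁅ x , y ⁆) +ᴹ (⁅ y , x ⁆ +ᴹ 0ᴹ)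
      ≈⟨ +ᴹ-cong (+ᴹ-congʳ (⁅⁆-alt x)) (+ᴹ-congˡ (⁅⁆-alt y)) ⟨
    (⁅ x , x ⁆ +ᴹ ⁅ x , y ⁆) +ᴹ (⁅ y , x ⁆ +ᴹ ⁅ y , y ⁆)
      ≈⟨ +ᴹ-cong (⁅⁆-+ʳ _ _ _) (⁅⁆-+ʳ _ _ _) ⟨
    ⁅ x , x +ᴹ y ⁆ +ᴹ ⁅ y , x +ᴹ y ⁆
      ≈⟨ ⁅⁆-+ˡ _ _ _ ⟨
    ⁅ x +ᴹ y , x +ᴹ y ⁆
      ≈⟨ ⁅⁆-alt _ ⟩
    0ᴹ ∎)

  ⁅⁆-anticomm-zero : ⁅ x , y ⁆ ≈ᴹ 0ᴹ → ⁅ y , x ⁆ ≈ᴹ 0ᴹ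
  ⁅⁆-anticomm-zero ⁅x,y⁆≈0 = ≈ᴹ-trans ⁅⁆-anticomm (≈ᴹ-trans (-ᴹ‿cong ⁅x,y⁆≈0) ε⁻¹≈ε)

  ⁅⁆-flipʳ : ⁅ x , ⁅ y , z ⁆ ⁆ ≈ᴹ -ᴹ ⁅ x , ⁅ z , y ⁆ ⁆
  ⁅⁆-flipʳ = ≈ᴹ-trans (⁅⁆-congʳ ⁅⁆-anticomm) ⁅⁆-negʳ

  ⁅⁆-flipʳ-neg : ⁅ x , ⁅ y , z ⁆ ⁆ ≈ᴹ -ᴹ t → ⁅ x , ⁅ z , y ⁆ ⁆ ≈ᴹ t
  ⁅⁆-flipʳ-neg h = ≈ᴹ-trans ⁅⁆-flipʳ (≈ᴹ-trans (-ᴹ‿cong h) (⁻¹-involutive _))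

  ⁅⁆-leibniz : ⁅ x , ⁅ y , z ⁆ ⁆ ≈ᴹ ⁅ ⁅ x , y ⁆ , z ⁆ +ᴹ ⁅ y , ⁅ x , z ⁆ ⁆
  ⁅⁆-leibniz {x} {y} {z} = begin
    ⁅ x , ⁅ y , z ⁆ ⁆
      ≈⟨ inverseˡ-unique _ _ (≈ᴹ-trans (≈ᴹ-sym (+ᴹ-assoc _ _ _)) (⁅⁆-jacobi x y z)) ⟩
    -ᴹ (⁅ y , ⁅ z , x ⁆ ⁆ +ᴹ ⁅ z , ⁅ x , y ⁆ ⁆)
      ≈⟨ -ᴹ‿cong (+ᴹ-cong ⁅⁆-flipʳ ⁅⁆-anticomm) ⟩
    -ᴹ (-ᴹ ⁅ y , ⁅ x , z ⁆ ⁆ +ᴹ -ᴹ ⁅ ⁅ x , y ⁆ , z ⁆)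
      ≈⟨ -ᴹ‿cong (⁻¹-∙-comm _ _) ⟩
    -ᴹ (-ᴹ (⁅ y , ⁅ x , z ⁆ ⁆ +ᴹ ⁅ ⁅ x , y ⁆ , z ⁆))
      ≈⟨ ⁻¹-involutive _ ⟩
    ⁅ y , ⁅ x , z ⁆ ⁆ +ᴹ ⁅ ⁅ x , y ⁆ , z ⁆
      ≈⟨ +ᴹ-comm _ _ ⟩
    ⁅ ⁅ x , y ⁆ , z ⁆ +ᴹ ⁅ y , ⁅ x , z ⁆ ⁆ ∎

  ⁅⁆-jacobiˡ : ⁅ ⁅ x , y ⁆ , z ⁆ ≈ᴹ ⁅ x , ⁅ y , z ⁆ ⁆ +ᴹ -ᴹ ⁅ y , ⁅ x , z ⁆ ⁆
  ⁅⁆-jacobiˡ = ≈ᴹ-trans (≈ᴹ-sym (//-rightDividesʳ _ _)) (+ᴹ-congʳ (≈ᴹ-sym ⁅⁆-leibniz))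

  ⁅⁆-commute-swap : ⁅ x , y ⁆ ≈ᴹ 0ᴹ → ⁅ x , ⁅ y , z ⁆ ⁆ ≈ᴹ ⁅ y , ⁅ x , z ⁆ ⁆
  ⁅⁆-commute-swap ⁅x,y⁆≈0 =
    ≈ᴹ-trans ⁅⁆-leibniz (≈ᴹ-trans (+ᴹ-congʳ (≈ᴹ-trans (⁅⁆-congˡ ⁅x,y⁆≈0) ⁅⁆-zeroˡ)) (+ᴹ-identityˡ _))

  ⁅⁆-commute-assoc : ⁅ x , z ⁆ ≈ᴹ 0ᴹ → ⁅ x , ⁅ y , z ⁆ ⁆ ≈ᴹ ⁅ ⁅ x , y ⁆ , z ⁆
  ⁅⁆-commute-assoc ⁅x,z⁆≈0 =
    ≈ᴹ-trans ⁅⁆-leibniz (≈ᴹ-trans (+ᴹ-congˡ (≈ᴹ-trans (⁅⁆-congʳ ⁅x,z⁆≈0) ⁅⁆-zeroʳ)) (+ᴹ-identityʳ _))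

  commutes-⁅⁆ʳ : ⁅ x , y ⁆ ≈ᴹ 0ᴹ → ⁅ x , z ⁆ ≈ᴹ 0ᴹ → ⁅ x , ⁅ y , z ⁆ ⁆ ≈ᴹ 0ᴹ
  commutes-⁅⁆ʳ ⁅x,y⁆≈0 ⁅x,z⁆≈0 =
    ≈ᴹ-trans (⁅⁆-commute-swap ⁅x,y⁆≈0) (≈ᴹ-trans (⁅⁆-congʳ ⁅x,z⁆≈0) ⁅⁆-zeroʳ)

  commutes-⁅⁆ˡ : ⁅ x , z ⁆ ≈ᴹ 0ᴹ → ⁅ y , z ⁆ ≈ᴹ 0ᴹ → ⁅ ⁅ x , y ⁆ , z ⁆ ≈ᴹ 0ᴹ
  commutes-⁅⁆ˡ ⁅x,z⁆≈0 ⁅y,z⁆≈0 =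
    ⁅⁆-anticomm-zero (commutes-⁅⁆ʳ (⁅⁆-anticomm-zero ⁅x,z⁆≈0) (⁅⁆-anticomm-zero ⁅y,z⁆≈0))

  ⁅⁆-leibniz³ : ⁅ x , ⁅ x , ⁅ x , y ⁆ ⁆ ⁆ ≈ᴹ 0ᴹ → ⁅ x , ⁅ x , ⁅ x , z ⁆ ⁆ ⁆ ≈ᴹ 0ᴹ →
                ⁅ x , ⁅ x , ⁅ x , ⁅ y , z ⁆ ⁆ ⁆ ⁆
                  ≈ᴹ 3 ×ᴹ (⁅ ⁅ x , y ⁆ , ⁅ x , ⁅ x , z ⁆ ⁆ ⁆ +ᴹ ⁅ ⁅ x , ⁅ x , y ⁆ ⁆ , ⁅ x , z ⁆ ⁆)
  ⁅⁆-leibniz³ {x} {y} {z} y₃≈0 z₃≈0 = begin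
    ⁅ x , ⁅ x , ⁅ x , ⁅ y , z ⁆ ⁆ ⁆ ⁆
      ≈⟨ ⁅⁆-congʳ leibniz² ⟩
    ⁅ x , (⁅ y₂ , z ⁆ +ᴹ ⁅ y₁ , z₁ ⁆) +ᴹ (⁅ y₁ , z₁ ⁆ +ᴹ ⁅ y , z₂ ⁆) ⁆
      ≈⟨ ≈ᴹ-trans (⁅⁆-+ʳ _ _ _) (+ᴹ-cong (⁅⁆-+ʳ _ _ _) (⁅⁆-+ʳ _ _ _)) ⟩
    (⁅ x , ⁅ y₂ , z ⁆ ⁆ +ᴹ ⁅ x , ⁅ y₁ , z₁ ⁆ ⁆) +ᴹ (⁅ x , ⁅ y₁ , z₁ ⁆ ⁆ +ᴹ ⁅ x , ⁅ y , z₂ ⁆ ⁆)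
      ≈⟨ +ᴹ-cong (+ᴹ-cong (⁅⁆-commute-swap y₃≈0) ⁅⁆-leibniz)
                 (+ᴹ-cong ⁅⁆-leibniz (⁅⁆-commute-assoc z₃≈0)) ⟩
    (B +ᴹ (B +ᴹ A)) +ᴹ ((B +ᴹ A) +ᴹ A)
      ≈⟨ solve 2 (λ a b → (b ⊕ (b ⊕ a)) ⊕ ((b ⊕ a) ⊕ a) ⊜ (a ⊕ b) ⊕ ((a ⊕ b) ⊕ ((a ⊕ b) ⊕ id)))
               ≈ᴹ-refl A B ⟩
    3 ×ᴹ (A +ᴹ B) ∎
    where
    y₁ y₂ z₁ z₂ A B : Carrierᴹ
    y₁ = ⁅ x , y ⁆
    y₂ = ⁅ x , y₁ ⁆
    z₁ = ⁅ x , z ⁆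
    z₂ = ⁅ x , z₁ ⁆
    A = ⁅ y₁ , z₂ ⁆
    B = ⁅ y₂ , z₁ ⁆

    leibniz² : ⁅ x , ⁅ x , ⁅ y , z ⁆ ⁆ ⁆
                 ≈ᴹ (⁅ y₂ , z ⁆ +ᴹ ⁅ y₁ , z₁ ⁆) +ᴹ (⁅ y₁ , z₁ ⁆ +ᴹ ⁅ y , z₂ ⁆)
    leibniz² = ≈ᴹ-trans (⁅⁆-congʳ ⁅⁆-leibniz)
                 (≈ᴹ-trans (⁅⁆-+ʳ _ _ _) (+ᴹ-cong ⁅⁆-leibniz ⁅⁆-leibniz))

  x≈-[x-y]⇒x+x≈y : x ≈ᴹ -ᴹ (x +ᴹ -ᴹ y) → x +ᴹ x ≈ᴹ y
  x≈-[x-y]⇒x+x≈y {x} {y} h = begin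
    x +ᴹ x                ≈⟨ +ᴹ-congˡ h ⟩
    x +ᴹ -ᴹ (x +ᴹ -ᴹ y)   ≈⟨ +ᴹ-congˡ (⁻¹-∙-comm _ _) ⟨
    x +ᴹ (-ᴹ x +ᴹ -ᴹ (-ᴹ y)) ≈⟨ +ᴹ-assoc _ _ _ ⟨
    (x +ᴹ -ᴹ x) +ᴹ -ᴹ (-ᴹ y) ≈⟨ +ᴹ-cong (-ᴹ‿inverseʳ x) (⁻¹-involutive y) ⟩
    0ᴹ +ᴹ y               ≈⟨ +ᴹ-identityˡ y ⟩
    y                     ∎

  module _ (charZero : CharZero K) where
    private module K = Field K

    natCast-*ₗ : ∀ N → natCast K.commRing N *ₗ x ≈ᴹ N ×ᴹ x
    natCast-*ₗ zero = *ₗ-zeroˡ _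
    natCast-*ₗ {x} (suc N) = begin
      (K.1# K.+ natCast K.commRing N) *ₗ x         ≈⟨ *ₗ-distribʳ x K.1# _ ⟩
      (K.1# *ₗ x) +ᴹ (natCast K.commRing N *ₗ x)   ≈⟨ +ᴹ-cong (*ₗ-identityˡ x) (natCast-*ₗ N) ⟩
      x +ᴹ N ×ᴹ x                                  ∎

    ×ᴹ≈0⇒≈0 : ∀ N → suc N ×ᴹ x ≈ᴹ 0ᴹ → x ≈ᴹ 0ᴹ
    ×ᴹ≈0⇒≈0 {x} N Nx≈0 with K.inverse (natCast K.commRing (suc N)) (charZero N)
    ... | k , N*k≈1 = begin
      x                                           ≈⟨ *ₗ-identityˡ x ⟨
      K.1# *ₗ x                                   ≈⟨ *ₗ-congʳ (K.trans (K.*-comm _ _) N*k≈1) ⟨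
      (k K.* natCast K.commRing (suc N)) *ₗ x     ≈⟨ *ₗ-assoc _ _ _ ⟩
      k *ₗ (natCast K.commRing (suc N) *ₗ x)      ≈⟨ *ₗ-congˡ (≈ᴹ-trans (natCast-*ₗ (suc N)) Nx≈0) ⟩
      k *ₗ 0ᴹ                                     ≈⟨ *ₗ-zeroʳ k ⟩
      0ᴹ                                          ∎

    x+x≈y+y⇒x≈y : x +ᴹ x ≈ᴹ y +ᴹ y → x ≈ᴹ y
    x+x≈y+y⇒x≈y {x} {y} h = x∙y⁻¹≈ε⇒x≈y x y (×ᴹ≈0⇒≈0 1 (begin
      (x +ᴹ -ᴹ y) +ᴹ ((x +ᴹ -ᴹ y) +ᴹ 0ᴹ)
        ≈⟨ solve 2 (λ a b → (a ⊕ b) ⊕ ((a ⊕ b) ⊕ id) ⊜ (a ⊕ a) ⊕ (b ⊕ b)) ≈ᴹ-refl x (-ᴹ y) ⟩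
      (x +ᴹ x) +ᴹ (-ᴹ y +ᴹ -ᴹ y)  ≈⟨ +ᴹ-cong h (⁻¹-∙-comm y y) ⟩
      (y +ᴹ y) +ᴹ -ᴹ (y +ᴹ y)    ≈⟨ -ᴹ‿inverseʳ _ ⟩
      0ᴹ                         ∎))

    module U₁₃Identities
      (e₁ e₂ e₃ : Carrierᴹ)
      (⁅e₁,e₃⁆≈0 : ⁅ e₁ , e₃ ⁆ ≈ᴹ 0ᴹ)
      (⁅e₂,⁅e₂,e₁⁆⁆≈-2e₂ : ⁅ e₂ , ⁅ e₂ , e₁ ⁆ ⁆ ≈ᴹ -ᴹ (e₂ +ᴹ e₂))
      (⁅e₂,⁅e₂,e₃⁆⁆≈-2e₂ : ⁅ e₂ , ⁅ e₂ , e₃ ⁆ ⁆ ≈ᴹ -ᴹ (e₂ +ᴹ e₂))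
      (⁅e₁,⁅e₁,⁅e₁,e₂⁆⁆⁆≈0 : ⁅ e₁ , ⁅ e₁ , ⁅ e₁ , e₂ ⁆ ⁆ ⁆ ≈ᴹ 0ᴹ)
      where

      w₁₂ w₂₃ u₁₂ w₁₃ u₁₃ : Carrierᴹ
      w₁₂ = ⁅ e₁ , e₂ ⁆
      w₂₃ = ⁅ e₂ , e₃ ⁆
      u₁₂ = ⁅ e₁ , w₁₂ ⁆
      w₁₃ = ⁅ e₁ , w₂₃ ⁆
      u₁₃ = ⁅ e₁ , w₁₃ ⁆

      ⁅e₂,u₁₂⁆≈2w₁₂ : ⁅ e₂ , u₁₂ ⁆ ≈ᴹ w₁₂ +ᴹ w₁₂
      ⁅e₂,u₁₂⁆≈2w₁₂ = begin
        ⁅ e₂ , ⁅ e₁ , w₁₂ ⁆ ⁆                          ≈⟨ ⁅⁆-leibniz ⟩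
        ⁅ ⁅ e₂ , e₁ ⁆ , w₁₂ ⁆ +ᴹ ⁅ e₁ , ⁅ e₂ , w₁₂ ⁆ ⁆  ≈⟨ +ᴹ-cong ⁅w₂₁,w₁₂⁆≈0 (⁅⁆-congʳ ⁅e₂,w₁₂⁆≈2e₂) ⟩
        0ᴹ +ᴹ ⁅ e₁ , e₂ +ᴹ e₂ ⁆                         ≈⟨ ≈ᴹ-trans (+ᴹ-identityˡ _) (⁅⁆-+ʳ _ _ _) ⟩
        w₁₂ +ᴹ w₁₂                                     ∎
        where
        ⁅e₂,w₁₂⁆≈2e₂ : ⁅ e₂ , w₁₂ ⁆ ≈ᴹ e₂ +ᴹ e₂
        ⁅e₂,w₁₂⁆≈2e₂ = ⁅⁆-flipʳ-neg ⁅e₂,⁅e₂,e₁⁆⁆≈-2e₂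
        ⁅w₂₁,w₁₂⁆≈0 : ⁅ ⁅ e₂ , e₁ ⁆ , w₁₂ ⁆ ≈ᴹ 0ᴹ
        ⁅w₂₁,w₁₂⁆≈0 = ≈ᴹ-trans (⁅⁆-congˡ ⁅⁆-anticomm)
                        (≈ᴹ-trans ⁅⁆-negˡ (≈ᴹ-trans (-ᴹ‿cong (⁅⁆-alt w₁₂)) ε⁻¹≈ε))

      ⁅w₁₂,u₁₂⁆≈2u₁₂ : ⁅ w₁₂ , u₁₂ ⁆ ≈ᴹ u₁₂ +ᴹ u₁₂
      ⁅w₁₂,u₁₂⁆≈2u₁₂ = begin
        ⁅ w₁₂ , u₁₂ ⁆                                       ≈⟨ ⁅⁆-jacobiˡ ⟩
        ⁅ e₁ , ⁅ e₂ , u₁₂ ⁆ ⁆ +ᴹ -ᴹ ⁅ e₂ , ⁅ e₁ , u₁₂ ⁆ ⁆    ≈⟨ +ᴹ-cong (⁅⁆-congʳ ⁅e₂,u₁₂⁆≈2w₁₂) (-ᴹ‿cong ⁅e₂,⁅e₁,u₁₂⁆⁆≈0) ⟩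
        ⁅ e₁ , w₁₂ +ᴹ w₁₂ ⁆ +ᴹ -ᴹ 0ᴹ                        ≈⟨ +ᴹ-cong (⁅⁆-+ʳ _ _ _) ε⁻¹≈ε ⟩
        (u₁₂ +ᴹ u₁₂) +ᴹ 0ᴹ                                  ≈⟨ +ᴹ-identityʳ _ ⟩
        u₁₂ +ᴹ u₁₂                                          ∎
        where
        ⁅e₂,⁅e₁,u₁₂⁆⁆≈0 : ⁅ e₂ , ⁅ e₁ , u₁₂ ⁆ ⁆ ≈ᴹ 0ᴹ
        ⁅e₂,⁅e₁,u₁₂⁆⁆≈0 = ≈ᴹ-trans (⁅⁆-congʳ ⁅e₁,⁅e₁,⁅e₁,e₂⁆⁆⁆≈0) ⁅⁆-zeroʳ

      ⁅w₁₂,e₃⁆≈w₁₃ : ⁅ w₁₂ , e₃ ⁆ ≈ᴹ w₁₃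
      ⁅w₁₂,e₃⁆≈w₁₃ = ≈ᴹ-sym (⁅⁆-commute-assoc ⁅e₁,e₃⁆≈0)

      ⁅u₁₂,e₃⁆≈u₁₃ : ⁅ u₁₂ , e₃ ⁆ ≈ᴹ u₁₃
      ⁅u₁₂,e₃⁆≈u₁₃ = ≈ᴹ-trans (≈ᴹ-sym (⁅⁆-commute-assoc ⁅e₁,e₃⁆≈0)) (⁅⁆-congʳ ⁅w₁₂,e₃⁆≈w₁₃)

      ⁅e₁,u₁₃⁆≈0 : ⁅ e₁ , u₁₃ ⁆ ≈ᴹ 0ᴹ
      ⁅e₁,u₁₃⁆≈0 = ≈ᴹ-trans (⁅⁆-congʳ (≈ᴹ-sym ⁅u₁₂,e₃⁆≈u₁₃)) (commutes-⁅⁆ʳ ⁅e₁,⁅e₁,⁅e₁,e₂⁆⁆⁆≈0 ⁅e₁,e₃⁆≈0)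

      ⁅w₁₂,u₁₃⁆≈2u₁₃+⁅u₁₂,w₁₃⁆ : ⁅ w₁₂ , u₁₃ ⁆ ≈ᴹ (u₁₃ +ᴹ u₁₃) +ᴹ ⁅ u₁₂ , w₁₃ ⁆
      ⁅w₁₂,u₁₃⁆≈2u₁₃+⁅u₁₂,w₁₃⁆ = begin
        ⁅ w₁₂ , u₁₃ ⁆                                          ≈⟨ ⁅⁆-congʳ ⁅u₁₂,e₃⁆≈u₁₃ ⟨
        ⁅ w₁₂ , ⁅ u₁₂ , e₃ ⁆ ⁆                                 ≈⟨ ⁅⁆-leibniz ⟩
        ⁅ ⁅ w₁₂ , u₁₂ ⁆ , e₃ ⁆ +ᴹ ⁅ u₁₂ , ⁅ w₁₂ , e₃ ⁆ ⁆       ≈⟨ +ᴹ-cong (⁅⁆-congˡ ⁅w₁₂,u₁₂⁆≈2u₁₂) (⁅⁆-congʳ ⁅w₁₂,e₃⁆≈w₁₃) ⟩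
        ⁅ u₁₂ +ᴹ u₁₂ , e₃ ⁆ +ᴹ ⁅ u₁₂ , w₁₃ ⁆                    ≈⟨ +ᴹ-congʳ (≈ᴹ-trans (⁅⁆-+ˡ _ _ _) (+ᴹ-cong ⁅u₁₂,e₃⁆≈u₁₃ ⁅u₁₂,e₃⁆≈u₁₃)) ⟩
        (u₁₃ +ᴹ u₁₃) +ᴹ ⁅ u₁₂ , w₁₃ ⁆                          ∎

      ⁅w₁₂,u₁₃⁆+⁅u₁₂,w₁₃⁆≈0 : ⁅ w₁₂ , u₁₃ ⁆ +ᴹ ⁅ u₁₂ , w₁₃ ⁆ ≈ᴹ 0ᴹ
      ⁅w₁₂,u₁₃⁆+⁅u₁₂,w₁₃⁆≈0 =
        ×ᴹ≈0⇒≈0 2 (≈ᴹ-trans (≈ᴹ-sym (⁅⁆-leibniz³ ⁅e₁,⁅e₁,⁅e₁,e₂⁆⁆⁆≈0 ⁅e₁,u₁₃⁆≈0)) (begin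
          ⁅ e₁ , ⁅ e₁ , ⁅ e₁ , ⁅ e₂ , w₂₃ ⁆ ⁆ ⁆ ⁆    ≈⟨ ⁅⁆-congʳ (⁅⁆-congʳ (⁅⁆-congʳ ⁅e₂,⁅e₂,e₃⁆⁆≈-2e₂)) ⟩
          ⁅ e₁ , ⁅ e₁ , ⁅ e₁ , -ᴹ (e₂ +ᴹ e₂) ⁆ ⁆ ⁆  ≈⟨ ⁅⁆-congʳ (⁅⁆-congʳ ⁅⁆-neg-doubleʳ) ⟩
          ⁅ e₁ , ⁅ e₁ , -ᴹ (w₁₂ +ᴹ w₁₂) ⁆ ⁆        ≈⟨ ⁅⁆-congʳ ⁅⁆-neg-doubleʳ ⟩
          ⁅ e₁ , -ᴹ (u₁₂ +ᴹ u₁₂) ⁆                 ≈⟨ ⁅⁆-neg-doubleʳ ⟩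
          -ᴹ (⁅ e₁ , u₁₂ ⁆ +ᴹ ⁅ e₁ , u₁₂ ⁆)         ≈⟨ -ᴹ‿cong (+ᴹ-cong ⁅e₁,⁅e₁,⁅e₁,e₂⁆⁆⁆≈0 ⁅e₁,⁅e₁,⁅e₁,e₂⁆⁆⁆≈0) ⟩
          -ᴹ (0ᴹ +ᴹ 0ᴹ)                           ≈⟨ ≈ᴹ-trans (-ᴹ‿cong (+ᴹ-identityʳ 0ᴹ)) ε⁻¹≈ε ⟩
          0ᴹ                                      ∎))

      ⁅w₁₂,u₁₃⁆≈u₁₃ : ⁅ w₁₂ , u₁₃ ⁆ ≈ᴹ u₁₃
      ⁅w₁₂,u₁₃⁆≈u₁₃ = x+x≈y+y⇒x≈y (begin
        ⁅ w₁₂ , u₁₃ ⁆ +ᴹ ⁅ w₁₂ , u₁₃ ⁆                        ≈⟨ +ᴹ-congʳ ⁅w₁₂,u₁₃⁆≈2u₁₃+⁅u₁₂,w₁₃⁆ ⟩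
        ((u₁₃ +ᴹ u₁₃) +ᴹ ⁅ u₁₂ , w₁₃ ⁆) +ᴹ ⁅ w₁₂ , u₁₃ ⁆      ≈⟨ +ᴹ-assoc _ _ _ ⟩
        (u₁₃ +ᴹ u₁₃) +ᴹ (⁅ u₁₂ , w₁₃ ⁆ +ᴹ ⁅ w₁₂ , u₁₃ ⁆)      ≈⟨ +ᴹ-congˡ (≈ᴹ-trans (+ᴹ-comm _ _) ⁅w₁₂,u₁₃⁆+⁅u₁₂,w₁₃⁆≈0) ⟩
        (u₁₃ +ᴹ u₁₃) +ᴹ 0ᴹ                                    ≈⟨ +ᴹ-identityʳ _ ⟩
        u₁₃ +ᴹ u₁₃                                            ∎)

      ⁅w₁₃,u₁₂⁆≈u₁₃ : ⁅ w₁₃ , u₁₂ ⁆ ≈ᴹ u₁₃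
      ⁅w₁₃,u₁₂⁆≈u₁₃ = begin
        ⁅ w₁₃ , u₁₂ ⁆            ≈⟨ ⁅⁆-anticomm ⟩
        -ᴹ ⁅ u₁₂ , w₁₃ ⁆         ≈⟨ -ᴹ‿cong (inverseʳ-unique _ _ ⁅w₁₂,u₁₃⁆+⁅u₁₂,w₁₃⁆≈0) ⟩
        -ᴹ (-ᴹ ⁅ w₁₂ , u₁₃ ⁆)    ≈⟨ ⁻¹-involutive _ ⟩
        ⁅ w₁₂ , u₁₃ ⁆            ≈⟨ ⁅w₁₂,u₁₃⁆≈u₁₃ ⟩
        u₁₃                      ∎

      ⁅e₁,⁅e₂,u₁₃⁆⁆≈u₁₃ : ⁅ e₁ , ⁅ e₂ , u₁₃ ⁆ ⁆ ≈ᴹ u₁₃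
      ⁅e₁,⁅e₂,u₁₃⁆⁆≈u₁₃ = ≈ᴹ-trans (⁅⁆-commute-assoc ⁅e₁,u₁₃⁆≈0) ⁅w₁₂,u₁₃⁆≈u₁₃

      module WithE₃
        (⁅e₃,⁅e₃,e₂⁆⁆≈-2e₃ : ⁅ e₃ , ⁅ e₃ , e₂ ⁆ ⁆ ≈ᴹ -ᴹ (e₃ +ᴹ e₃))
        where

        ⁅w₁₃,e₃⁆≈0 : ⁅ w₁₃ , e₃ ⁆ ≈ᴹ 0ᴹ
        ⁅w₁₃,e₃⁆≈0 = ⁅⁆-anticomm-zero (begin
          ⁅ e₃ , ⁅ e₁ , w₂₃ ⁆ ⁆    ≈⟨ ⁅⁆-commute-swap (⁅⁆-anticomm-zero ⁅e₁,e₃⁆≈0) ⟩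
          ⁅ e₁ , ⁅ e₃ , w₂₃ ⁆ ⁆    ≈⟨ ⁅⁆-congʳ (⁅⁆-flipʳ-neg ⁅e₃,⁅e₃,e₂⁆⁆≈-2e₃) ⟩
          ⁅ e₁ , e₃ +ᴹ e₃ ⁆        ≈⟨ ⁅⁆-+ʳ _ _ _ ⟩
          ⁅ e₁ , e₃ ⁆ +ᴹ ⁅ e₁ , e₃ ⁆ ≈⟨ +ᴹ-cong ⁅e₁,e₃⁆≈0 ⁅e₁,e₃⁆≈0 ⟩
          0ᴹ +ᴹ 0ᴹ                 ≈⟨ +ᴹ-identityʳ 0ᴹ ⟩
          0ᴹ                       ∎)

        ⁅u₁₃,e₃⁆≈0 : ⁅ u₁₃ , e₃ ⁆ ≈ᴹ 0ᴹ
        ⁅u₁₃,e₃⁆≈0 = commutes-⁅⁆ˡ ⁅e₁,e₃⁆≈0 ⁅w₁₃,e₃⁆≈0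

        ⁅w₁₃,u₁₃⁆≈0 : ⁅ w₁₃ , u₁₃ ⁆ ≈ᴹ 0ᴹ
        ⁅w₁₃,u₁₃⁆≈0 = begin
          ⁅ w₁₃ , u₁₃ ⁆              ≈⟨ ⁅⁆-congʳ ⁅u₁₂,e₃⁆≈u₁₃ ⟨
          ⁅ w₁₃ , ⁅ u₁₂ , e₃ ⁆ ⁆     ≈⟨ ⁅⁆-commute-assoc ⁅w₁₃,e₃⁆≈0 ⟩
          ⁅ ⁅ w₁₃ , u₁₂ ⁆ , e₃ ⁆     ≈⟨ ⁅⁆-congˡ ⁅w₁₃,u₁₂⁆≈u₁₃ ⟩
          ⁅ u₁₃ , e₃ ⁆               ≈⟨ ⁅u₁₃,e₃⁆≈0 ⟩
          0ᴹ                         ∎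

        module WithE₄
          (e₄ : Carrierᴹ)
          (⁅e₁,e₄⁆≈0 : ⁅ e₁ , e₄ ⁆ ≈ᴹ 0ᴹ)
          (⁅e₂,e₄⁆≈0 : ⁅ e₂ , e₄ ⁆ ≈ᴹ 0ᴹ)
          (⁅e₃,⁅e₃,e₄⁆⁆≈-2e₃ : ⁅ e₃ , ⁅ e₃ , e₄ ⁆ ⁆ ≈ᴹ -ᴹ (e₃ +ᴹ e₃))
          where

          w₃₄ w₂₄ w₁₄ : Carrierᴹ
          w₃₄ = ⁅ e₃ , e₄ ⁆
          w₂₄ = ⁅ e₂ , w₃₄ ⁆
          w₁₄ = ⁅ e₁ , w₂₄ ⁆

          ⁅e₄,u₁₃⁆≈-⁅u₁₂,w₃₄⁆ : ⁅ e₄ , u₁₃ ⁆ ≈ᴹ -ᴹ ⁅ u₁₂ , w₃₄ ⁆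
          ⁅e₄,u₁₃⁆≈-⁅u₁₂,w₃₄⁆ = begin
            ⁅ e₄ , u₁₃ ⁆             ≈⟨ ⁅⁆-congʳ ⁅u₁₂,e₃⁆≈u₁₃ ⟨
            ⁅ e₄ , ⁅ u₁₂ , e₃ ⁆ ⁆    ≈⟨ ⁅⁆-commute-swap ⁅e₄,u₁₂⁆≈0 ⟩
            ⁅ u₁₂ , ⁅ e₄ , e₃ ⁆ ⁆    ≈⟨ ⁅⁆-flipʳ ⟩
            -ᴹ ⁅ u₁₂ , w₃₄ ⁆         ∎
            where
            ⁅e₄,e₁⁆≈0 : ⁅ e₄ , e₁ ⁆ ≈ᴹ 0ᴹ
            ⁅e₄,e₁⁆≈0 = ⁅⁆-anticomm-zero ⁅e₁,e₄⁆≈0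
            ⁅e₄,u₁₂⁆≈0 : ⁅ e₄ , u₁₂ ⁆ ≈ᴹ 0ᴹ
            ⁅e₄,u₁₂⁆≈0 = commutes-⁅⁆ʳ ⁅e₄,e₁⁆≈0 (commutes-⁅⁆ʳ ⁅e₄,e₁⁆≈0 (⁅⁆-anticomm-zero ⁅e₂,e₄⁆≈0))

          ⁅w₃₄,u₁₃⁆≈u₁₃ : ⁅ w₃₄ , u₁₃ ⁆ ≈ᴹ u₁₃
          ⁅w₃₄,u₁₃⁆≈u₁₃ = x+x≈y+y⇒x≈y (x≈-[x-y]⇒x+x≈y (begin
            ⁅ w₃₄ , u₁₃ ⁆
              ≈⟨ ⁅⁆-commute-assoc (⁅⁆-anticomm-zero ⁅u₁₃,e₃⁆≈0) ⟨
            ⁅ e₃ , ⁅ e₄ , u₁₃ ⁆ ⁆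
              ≈⟨ ≈ᴹ-trans (⁅⁆-congʳ ⁅e₄,u₁₃⁆≈-⁅u₁₂,w₃₄⁆) ⁅⁆-negʳ ⟩
            -ᴹ ⁅ e₃ , ⁅ u₁₂ , w₃₄ ⁆ ⁆
              ≈⟨ -ᴹ‿cong ⁅⁆-leibniz ⟩
            -ᴹ (⁅ ⁅ e₃ , u₁₂ ⁆ , w₃₄ ⁆ +ᴹ ⁅ u₁₂ , ⁅ e₃ , w₃₄ ⁆ ⁆)
              ≈⟨ -ᴹ‿cong (+ᴹ-cong ⁅⁅e₃,u₁₂⁆,w₃₄⁆≈⁅w₃₄,u₁₃⁆ ⁅u₁₂,⁅e₃,w₃₄⁆⁆≈-2u₁₃) ⟩
            -ᴹ (⁅ w₃₄ , u₁₃ ⁆ +ᴹ -ᴹ (u₁₃ +ᴹ u₁₃)) ∎))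
            where
            ⁅⁅e₃,u₁₂⁆,w₃₄⁆≈⁅w₃₄,u₁₃⁆ : ⁅ ⁅ e₃ , u₁₂ ⁆ , w₃₄ ⁆ ≈ᴹ ⁅ w₃₄ , u₁₃ ⁆
            ⁅⁅e₃,u₁₂⁆,w₃₄⁆≈⁅w₃₄,u₁₃⁆ = begin
              ⁅ ⁅ e₃ , u₁₂ ⁆ , w₃₄ ⁆   ≈⟨ ⁅⁆-congˡ (≈ᴹ-trans ⁅⁆-anticomm (-ᴹ‿cong ⁅u₁₂,e₃⁆≈u₁₃)) ⟩
              ⁅ -ᴹ u₁₃ , w₃₄ ⁆         ≈⟨ ⁅⁆-negˡ ⟩
              -ᴹ ⁅ u₁₃ , w₃₄ ⁆         ≈⟨ -ᴹ‿cong ⁅⁆-anticomm ⟩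
              -ᴹ (-ᴹ ⁅ w₃₄ , u₁₃ ⁆)    ≈⟨ ⁻¹-involutive _ ⟩
              ⁅ w₃₄ , u₁₃ ⁆            ∎
            ⁅u₁₂,⁅e₃,w₃₄⁆⁆≈-2u₁₃ : ⁅ u₁₂ , ⁅ e₃ , w₃₄ ⁆ ⁆ ≈ᴹ -ᴹ (u₁₃ +ᴹ u₁₃)
            ⁅u₁₂,⁅e₃,w₃₄⁆⁆≈-2u₁₃ = begin
              ⁅ u₁₂ , ⁅ e₃ , w₃₄ ⁆ ⁆                ≈⟨ ⁅⁆-congʳ ⁅e₃,⁅e₃,e₄⁆⁆≈-2e₃ ⟩
              ⁅ u₁₂ , -ᴹ (e₃ +ᴹ e₃) ⁆               ≈⟨ ⁅⁆-neg-doubleʳ ⟩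
              -ᴹ (⁅ u₁₂ , e₃ ⁆ +ᴹ ⁅ u₁₂ , e₃ ⁆)     ≈⟨ -ᴹ‿cong (+ᴹ-cong ⁅u₁₂,e₃⁆≈u₁₃ ⁅u₁₂,e₃⁆≈u₁₃) ⟩
              -ᴹ (u₁₃ +ᴹ u₁₃)                       ∎

          ⁅w₁₄,u₁₃⁆≈0 : ⁅ w₁₄ , u₁₃ ⁆ ≈ᴹ 0ᴹ
          ⁅w₁₄,u₁₃⁆≈0 = begin
            ⁅ ⁅ e₁ , w₂₄ ⁆ , u₁₃ ⁆
              ≈⟨ ⁅⁆-commute-assoc ⁅e₁,u₁₃⁆≈0 ⟨
            ⁅ e₁ , ⁅ w₂₄ , u₁₃ ⁆ ⁆
              ≈⟨ ≈ᴹ-trans (⁅⁆-congʳ ⁅⁆-jacobiˡ) (⁅⁆-+ʳ _ _ _) ⟩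
            ⁅ e₁ , ⁅ e₂ , ⁅ w₃₄ , u₁₃ ⁆ ⁆ ⁆ +ᴹ ⁅ e₁ , -ᴹ ⁅ w₃₄ , ⁅ e₂ , u₁₃ ⁆ ⁆ ⁆
              ≈⟨ +ᴹ-cong (⁅⁆-congʳ (⁅⁆-congʳ ⁅w₃₄,u₁₃⁆≈u₁₃)) ⁅⁆-negʳ ⟩
            ⁅ e₁ , ⁅ e₂ , u₁₃ ⁆ ⁆ +ᴹ -ᴹ ⁅ e₁ , ⁅ w₃₄ , ⁅ e₂ , u₁₃ ⁆ ⁆ ⁆
              ≈⟨ +ᴹ-congˡ (-ᴹ‿cong (⁅⁆-commute-swap (commutes-⁅⁆ʳ ⁅e₁,e₃⁆≈0 ⁅e₁,e₄⁆≈0))) ⟩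
            ⁅ e₁ , ⁅ e₂ , u₁₃ ⁆ ⁆ +ᴹ -ᴹ ⁅ w₃₄ , ⁅ e₁ , ⁅ e₂ , u₁₃ ⁆ ⁆ ⁆
              ≈⟨ +ᴹ-cong ⁅e₁,⁅e₂,u₁₃⁆⁆≈u₁₃
                         (-ᴹ‿cong (≈ᴹ-trans (⁅⁆-congʳ ⁅e₁,⁅e₂,u₁₃⁆⁆≈u₁₃) ⁅w₃₄,u₁₃⁆≈u₁₃)) ⟩
            u₁₃ +ᴹ -ᴹ u₁₃
              ≈⟨ -ᴹ‿inverseʳ u₁₃ ⟩
            0ᴹ ∎

    module ElectricalCn (n : ℕ) (3≤n : 3 ≤ n) (e : ℕ → Carrierᴹ) (rel : IsElectricalCn L n e) where

      far-commute : ∀ {i j} → 1 ≤ i → i + 2 ≤ j → j ≤ n → ⁅ e i , e j ⁆ ≈ᴹ 0ᴹ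
      far-commute {i} {j} 1≤i i+2≤j j≤n = proj₁ rel _ _ 1≤i i≤n (≤-trans 1≤i i≤j) j≤n (inj₂ i+2≤j)
        where
        i≤j : i ≤ j
        i≤j = ≤-trans (m≤m+n i 2) i+2≤j
        i≤n : i ≤ n
        i≤n = ≤-trans i≤j j≤n

      adjacent : ∀ i j → 2 ≤ i → i ≤ n → 1 ≤ j → j ≤ n → (j ≡ suc i) ⊎ (i ≡ suc j) →
                 ⁅ e i , ⁅ e i , e j ⁆ ⁆ ≈ᴹ -ᴹ (e i +ᴹ e i)
      adjacent = proj₁ (proj₂ rel)

      2≤n : 2 ≤ n
      2≤n = ≤-trans (n≤1+n 2) 3≤n

      1≤n : 1 ≤ n
      1≤n = ≤-trans (n≤1+n 1) 2≤n

      open U₁₃Identities (e 1) (e 2) (e 3)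
        (far-commute (s≤s z≤n) ≤-refl 3≤n)
        (adjacent 2 1 (s≤s (s≤s z≤n)) 2≤n (s≤s z≤n) 1≤n (inj₂ refl))
        (adjacent 2 3 (s≤s (s≤s z≤n)) 2≤n (s≤s z≤n) 3≤n (inj₁ refl))
        (proj₂ (proj₂ rel))
        public
      open WithE₃ (adjacent 3 2 (s≤s (s≤s z≤n)) 3≤n (s≤s z≤n) 2≤n (inj₂ refl)) public

      module AtLeastFour (4≤n : 4 ≤ n) =
        WithE₄ (e 4) (far-commute (s≤s z≤n) (n≤1+n 3) 4≤n) (far-commute (s≤s z≤n) ≤-refl 4≤n)
               (adjacent 3 4 (s≤s (s≤s z≤n)) 3≤n (s≤s z≤n) 4≤n (inj₁ refl))

      far-commute-w' : ∀ {p} k j → 1 ≤ p → p + 2 ≤ k → k + j ≤ n → ⁅ e p , w' L e k j ⁆ ≈ᴹ 0ᴹ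
      far-commute-w' k zero    1≤p p+2≤k k+0≤n = far-commute 1≤p p+2≤k (≤-trans (m≤m+n k 0) k+0≤n)
      far-commute-w' k (suc j) 1≤p p+2≤k k+1+j≤n =
        commutes-⁅⁆ʳ (far-commute-w' k zero 1≤p p+2≤k (≤-trans (+-monoʳ-≤ k z≤n) k+1+j≤n))
                     (far-commute-w' (suc k) j 1≤p (≤-trans p+2≤k (n≤1+n k)) (subst (_≤ n) (+-suc k j) k+1+j≤n))

      ⁅w',u₁₃⁆≈0 : ∀ k j → 5 ≤ k → k + j ≤ n → ⁅ w' L e k j , u₁₃ ⁆ ≈ᴹ 0ᴹ
      ⁅w',u₁₃⁆≈0 k j 5≤k k+j≤n =
        ⁅⁆-anticomm-zero (commutes-⁅⁆ˡ (⁅eₚ,X⁆≈0 3≤k) (commutes-⁅⁆ˡ (⁅eₚ,X⁆≈0 3≤k)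
                           (commutes-⁅⁆ˡ (⁅eₚ,X⁆≈0 4≤k) (⁅eₚ,X⁆≈0 5≤k))))
        where
        ⁅eₚ,X⁆≈0 : ∀ {p} → suc p + 2 ≤ k → ⁅ e (suc p) , w' L e k j ⁆ ≈ᴹ 0ᴹ
        ⁅eₚ,X⁆≈0 p+2≤k = far-commute-w' k j (s≤s z≤n) p+2≤k k+j≤n
        4≤k : 4 ≤ k
        4≤k = ≤-trans (n≤1+n 4) 5≤k
        3≤k : 3 ≤ k
        3≤k = ≤-trans (n≤1+n 3) 4≤k

      ⁅w₁ⱼ,u₁₃⁆≈0 : ∀ j → 3 ≤ j → j ≤ n → ⁅ w L e 1 j , u₁₃ ⁆ ≈ᴹ 0ᴹ
      ⁅w₁ⱼ,u₁₃⁆≈0 1 (s≤s ()) _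
      ⁅w₁ⱼ,u₁₃⁆≈0 2 (s≤s (s≤s ())) _
      ⁅w₁ⱼ,u₁₃⁆≈0 3 _ _   = ⁅w₁₃,u₁₃⁆≈0
      ⁅w₁ⱼ,u₁₃⁆≈0 4 _ 4≤n = AtLeastFour.⁅w₁₄,u₁₃⁆≈0 4≤n
      ⁅w₁ⱼ,u₁₃⁆≈0 (suc (suc (suc (suc (suc m))))) _ j≤n = begin
        ⁅ ⁅ e 1 , ⁅ e 2 , ⁅ e 3 , ⁅ e 4 , X ⁆ ⁆ ⁆ ⁆ , u₁₃ ⁆
          ≈⟨ ⁅⁆-congˡ (⁅⁆-congʳ (⁅⁆-congʳ (⁅⁆-commute-assoc (far-commute-w' 5 m (s≤s z≤n) ≤-refl j≤n)))) ⟩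
        ⁅ ⁅ e 1 , ⁅ e 2 , ⁅ w₃₄ , X ⁆ ⁆ ⁆ , u₁₃ ⁆
          ≈⟨ ⁅⁆-congˡ (⁅⁆-congʳ (⁅⁆-commute-assoc (far-commute-w' 5 m (s≤s z≤n) (n≤1+n 4) j≤n))) ⟩
        ⁅ ⁅ e 1 , ⁅ w₂₄ , X ⁆ ⁆ , u₁₃ ⁆
          ≈⟨ ⁅⁆-congˡ (⁅⁆-commute-assoc (far-commute-w' 5 m (s≤s z≤n) (s≤s (s≤s (s≤s z≤n))) j≤n)) ⟩
        ⁅ ⁅ w₁₄ , X ⁆ , u₁₃ ⁆
          ≈⟨ commutes-⁅⁆ˡ ⁅w₁₄,u₁₃⁆≈0 (⁅w',u₁₃⁆≈0 5 m ≤-refl j≤n) ⟩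
        0ᴹ ∎
        where
        X : Carrierᴹ
        X = w' L e 5 m
        open AtLeastFour (≤-trans (s≤s (s≤s (s≤s (s≤s z≤n)))) j≤n)

      ⁅w₂ᵢ₊₁,ⱼ,u₁₃⁆≈0 : ∀ i j → 1 ≤ i → 2 * i + 1 < j → j ≤ n → ¬ (j ≡ 4) →
                        ⁅ w L e (2 * i + 1) j , u₁₃ ⁆ ≈ᴹ 0ᴹ
      ⁅w₂ᵢ₊₁,ⱼ,u₁₃⁆≈0 1 1 _ (s≤s ()) _ _
      ⁅w₂ᵢ₊₁,ⱼ,u₁₃⁆≈0 1 2 _ (s≤s (s≤s ())) _ _
      ⁅w₂ᵢ₊₁,ⱼ,u₁₃⁆≈0 1 3 _ (s≤s (s≤s (s≤s ()))) _ _
      ⁅w₂ᵢ₊₁,ⱼ,u₁₃⁆≈0 1 4 _ _ _ j≢4 = ⊥-elim (j≢4 refl)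
      ⁅w₂ᵢ₊₁,ⱼ,u₁₃⁆≈0 1 (suc (suc (suc (suc (suc m))))) _ _ j≤n _ = begin
        ⁅ ⁅ e 3 , ⁅ e 4 , X ⁆ ⁆ , u₁₃ ⁆
          ≈⟨ ⁅⁆-congˡ (⁅⁆-commute-assoc (far-commute-w' 5 m (s≤s z≤n) ≤-refl j≤n)) ⟩
        ⁅ ⁅ w₃₄ , X ⁆ , u₁₃ ⁆
          ≈⟨ ⁅⁆-jacobiˡ ⟩
        ⁅ w₃₄ , ⁅ X , u₁₃ ⁆ ⁆ +ᴹ -ᴹ ⁅ X , ⁅ w₃₄ , u₁₃ ⁆ ⁆
          ≈⟨ +ᴹ-cong (≈ᴹ-trans (⁅⁆-congʳ ⁅X,u₁₃⁆≈0) ⁅⁆-zeroʳ)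
                     (-ᴹ‿cong (≈ᴹ-trans (⁅⁆-congʳ ⁅w₃₄,u₁₃⁆≈u₁₃) ⁅X,u₁₃⁆≈0)) ⟩
        0ᴹ +ᴹ -ᴹ 0ᴹ
          ≈⟨ -ᴹ‿inverseʳ 0ᴹ ⟩
        0ᴹ ∎
        where
        X : Carrierᴹ
        X = w' L e 5 m
        ⁅X,u₁₃⁆≈0 : ⁅ X , u₁₃ ⁆ ≈ᴹ 0ᴹ
        ⁅X,u₁₃⁆≈0 = ⁅w',u₁₃⁆≈0 5 m ≤-refl j≤n
        open AtLeastFour (≤-trans (s≤s (s≤s (s≤s (s≤s z≤n)))) j≤n)
      ⁅w₂ᵢ₊₁,ⱼ,u₁₃⁆≈0 (suc (suc i)) j _ k<j j≤n _ =
        ⁅w',u₁₃⁆≈0 k (j ∸ k) 5≤k (subst (_≤ n) (sym (m+[n∸m]≡n (<⇒≤ k<j))) j≤n)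
        where
        k : ℕ
        k = 2 * suc (suc i) + 1
        5≤k : 5 ≤ k
        5≤k = +-monoˡ-≤ 1 (*-monoʳ-≤ 2 (s≤s (s≤s (z≤n {i}))))

lemma2p11 : {c ℓ m ℓm : Level} (K : Field c ℓ) → CharZero K →
    (L : LieAlgebra K m ℓm) → (n : ℕ) → 3 ≤ n → (e : ℕ → LieAlgebra.Carrierᴹ L) →
    IsElectricalCn L n e →
      (LieAlgebra._≈ᴹ_ L (LieAlgebra.⁅_,_⁆ L (LieAlgebra.⁅_,_⁆ L (e 1) (e 2)) (u13 L e)) (u13 L e))
    × (4 ≤ n →
       LieAlgebra._≈ᴹ_ L (LieAlgebra.⁅_,_⁆ L (LieAlgebra.⁅_,_⁆ L (e 3) (e 4)) (u13 L e)) (u13 L e))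
    × (∀ i j → 1 ≤ i → 2 * i + 1 < j → j ≤ n → ¬ (j ≡ 4) →
       LieAlgebra._≈ᴹ_ L (LieAlgebra.⁅_,_⁆ L (w L e (2 * i + 1) j) (u13 L e)) (LieAlgebra.0ᴹ L))
    × (∀ j → 3 ≤ j → j ≤ n →
       LieAlgebra._≈ᴹ_ L (LieAlgebra.⁅_,_⁆ L (w L e 1 j) (u13 L e)) (LieAlgebra.0ᴹ L))
lemma2p11 K charZero L n 3≤n e rel =
  ⁅w₁₂,u₁₃⁆≈u₁₃ , (λ 4≤n → AtLeastFour.⁅w₃₄,u₁₃⁆≈u₁₃ 4≤n) , ⁅w₂ᵢ₊₁,ⱼ,u₁₃⁆≈0 , ⁅w₁ⱼ,u₁₃⁆≈0
  where open ElectricalCn L charZero n 3≤n e rel
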